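{- Let $G$ be a connected unit disk graph. Heuristic CDOM (described below) computes a connected dominating set of $G$ whose size is at most 10 times the size of a minimum connected dominating set of $G$, and at most 10 times the size of a minimum total dominating set of $G$. Heuristic CDOM: (1) Pick an arbitrary vertex $v$. (2) Construct a breadth-first spanning tree $T$ of $G$ rooted at $v$, let $k$ be its depth, and let $S_i$ be the set of vertices at level $i$ of $T$, $0\le i\le k$. (3) Set $IS_0=\{v\}$, $NS_0=\emptyset$. (4) For $i=1,\dots,k$: let $DS_i$ be the set of vertices in $S_i$ adjacent to some vertex of $IS_{i-1}$; pick a maximal independent set $IS_i$ in the induced subgraph $G(S_i\setminus DS_i)$; let $NS_i$ be the set of parents in $T$ of the vertices of $IS_i$. (5) Output $\left(\bigcup_{i=0}^k IS_i\right)\cup\left(\bigcup_{i=0}^k NS_i\right)$.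
   Context: A graph is a unit disk graph if its vertices can be put in one-to-one correspondence with circles of radius 1 in the plane so that two vertices are adjacent if and only if the corresponding closed disks intersect (tangent circles intersect). A dominating set is a set $V'$ such that every vertex outside $V'$ has a neighbor in $V'$; a connected dominating set is a dominating set inducing a connected subgraph; a total dominating set is a set $V'$ such that every vertex of $G$ (including those in $V'$) has a neighbor in $V'$.
   Formalization: The circles realizing the unit disk graph have centres with rational coordinates rather than arbitrary points of the plane. -}

module Defs where

open import Data.Nat using (ℕ; zero; suc; _≤_; _+_)
open import Data.Fin using (Fin)
open import Data.Fin.Subset using (Subset; _∈_; _∉_)
open import Data.Product using (Σ; ∃; _×_; _,_)
open import Data.Sum using (_⊎_)
open import Data.Rational using (ℚ; 1ℚ) renaming (_+_ to _+ℚ_; _*_ to _*ℚ_; _-_ to _-ℚ_; _≤_ to _≤ℚ_)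
open import Relation.Nullary using (¬_)
open import Relation.Binary.PropositionalEquality using (_≡_; _≢_)
open import Function.Bundles using (_⇔_)

record Graph (n : ℕ) : Set₁ where
  field
    Adj    : Fin n → Fin n → Set
    sym    : ∀ {u w} → Adj u w → Adj w u
    irrefl : ∀ {u} → ¬ Adj u u
open Graph public

Point : Set
Point = ℚ × ℚ

sqDist : Point → Point → ℚ
sqDist (x₁ , y₁) (x₂ , y₂) = ((x₁ -ℚ x₂) *ℚ (x₁ -ℚ x₂)) +ℚ ((y₁ -ℚ y₂) *ℚ (y₁ -ℚ y₂))

four : ℚ
four = 1ℚ +ℚ 1ℚ +ℚ 1ℚ +ℚ 1ℚ

-- Unit disk graph: distinct centres of radius-1 circles, u ~ w iff the closed
-- disks intersect, i.e. |c u - c w| ≤ 2, i.e. squared distance ≤ 4.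
UnitDisk : ∀ {n} → Graph n → Set
UnitDisk {n} G = Σ (Fin n → Point) λ c →
    (∀ u w → c u ≡ c w → u ≡ w)
  × (∀ u w → u ≢ w → (Adj G u w ⇔ (sqDist (c u) (c w) ≤ℚ four)))

data Walk {n} (G : Graph n) : Fin n → Fin n → ℕ → Set where
  here : ∀ {u} → Walk G u u zero
  step : ∀ {u w x k} → Adj G u w → Walk G w x k → Walk G u x (suc k)

Connected : ∀ {n} → Graph n → Set
Connected {n} G = ∀ (u w : Fin n) → ∃ λ k → Walk G u w k

-- Walks staying inside a vertex subset S (for induced subgraph G(S)).
data WalkIn {n} (G : Graph n) (S : Subset n) : Fin n → Fin n → Set where
  here : ∀ {u} → u ∈ S → WalkIn G S u u
  step : ∀ {u w x} → u ∈ S → Adj G u w → WalkIn G S w x → WalkIn G S u x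

Dominating : ∀ {n} → Graph n → Subset n → Set
Dominating {n} G D = ∀ (u : Fin n) → u ∉ D → ∃ λ w → w ∈ D × Adj G u w

ConnectedDominating : ∀ {n} → Graph n → Subset n → Set
ConnectedDominating {n} G D =
  Dominating G D × (∀ (u w : Fin n) → u ∈ D → w ∈ D → WalkIn G D u w)

TotalDominating : ∀ {n} → Graph n → Subset n → Set
TotalDominating {n} G D = ∀ (u : Fin n) → ∃ λ w → w ∈ D × Adj G u w

IsDist : ∀ {n} → Graph n → Fin n → Fin n → ℕ → Set
IsDist G v u d = Walk G v u d × (∀ j → Walk G v u j → d ≤ j)

-- One possible run of Heuristic CDOM on G, producing output D.
-- root v; lvl u = level of u in the BFS tree = distance from v;
-- par = parent map of the BFS spanning tree T (every non-root vertex's parent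
-- is an adjacent vertex one level up); IS i, NS i as in the heuristic
-- (for i beyond the depth k the level S_i is empty, so IS i, NS i are empty).
record CDOMRun {n} (G : Graph n) (D : Subset n) : Set where
  field
    v     : Fin n
    lvl   : Fin n → ℕ
    lvl-dist : ∀ u → IsDist G v u (lvl u)
    par   : Fin n → Fin n
    par-ok : ∀ u → u ≢ v → Adj G (par u) u × suc (lvl (par u)) ≡ lvl u
    IS NS : ℕ → Subset n
    IS₀   : ∀ u → (u ∈ IS 0 ⇔ u ≡ v)
    NS₀   : ∀ u → u ∉ NS 0
    -- IS_i ⊆ S_i ∖ DS_i, where DS_i = {u ∈ S_i | u adjacent to some vertex of IS_{i-1}}
    IS-level : ∀ i u → u ∈ IS (suc i) → lvl u ≡ suc i
    IS-notDS : ∀ i u w → u ∈ IS (suc i) → w ∈ IS i → ¬ Adj G u w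
    IS-indep : ∀ i u w → u ∈ IS (suc i) → w ∈ IS (suc i) → ¬ Adj G u w
    -- maximal in G(S_i ∖ DS_i)
    IS-max   : ∀ i u → lvl u ≡ suc i → (∀ w → w ∈ IS i → ¬ Adj G u w) →
               u ∉ IS (suc i) → ∃ λ w → w ∈ IS (suc i) × Adj G u w
    NS-def   : ∀ i u → (u ∈ NS (suc i) ⇔ ∃ λ w → w ∈ IS (suc i) × par w ≡ u)
    output   : ∀ u → (u ∈ D ⇔ ∃ λ i → u ∈ IS i ⊎ u ∈ NS i)

-- Let I be the union of the sets IS_i. Two vertices of I on the same BFS level are non-adjacent
-- by the choice of IS_i, a vertex of IS_{i+1} lies outside DS_{i+1}, and adjacent vertices are at
-- most one level apart; so I is independent. Every other output vertex is the BFS parent of a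
-- vertex of I, hence |D| ≤ 2|I|. In a unit disk graph a closed neighbourhood contains at most
-- five pairwise non-adjacent vertices: among six points at distance at most 2 from a centre,
-- two make an angle of at most 60° at the centre and are then at distance at most 2 from each
-- other. So an independent set is at most five times as large as any dominating set, connected
-- or total. Finally D is connected and dominating because every vertex of level i+1 is in
-- IS_{i+1} or adjacent to IS_i ∪ IS_{i+1}, and each vertex of IS_{i+1} reaches level i through
-- its parent, which lies in NS_{i+1}.
module Submission where

open import Defs renaming (sym to adj-sym)

module Plane where

  open import Data.Empty using (⊥-elim)
  open import Data.Fin using (Fin; zero; suc) renaming (_<_ to _<ᶠ_)
  open import Data.Fin.Properties using (any?; pigeonhole; suc-injective; <⇒≢)
  open import Data.Maybe using (Maybe; just; nothing)
  open import Data.Nat.Properties using (n<1+n)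
  open import Data.Product using (∃; ∃₂; _×_; _,_; proj₁; proj₂)
  open import Data.Rational
    using (ℚ; 0ℚ; 1ℚ; _+_; _*_; _-_; -_; _≤_; _<_; _≤?_; _<?_; positive; negative; nonNegative)
    renaming (_≟_ to _≟ℚ_)
  open import Data.Rational.Properties
    using (+-*-commutativeRing; ≤-total; ≤-refl; <⇒≤; ≮⇒≥; ≰⇒>; <-cmp; <-≤-trans; <-irrefl;
           +-comm; *-zeroʳ; +-inverseʳ; +-identityˡ; +-mono-≤; +-mono-<-≤; +-monoˡ-≤; +-monoˡ-<;
           neg-antimono-≤; neg-antimono-<; *-cancelˡ-≤-pos; positive⁻¹; nonNegative⁻¹;
           nonNeg*nonNeg⇒nonNeg; pos*pos⇒pos; neg*neg⇒pos; nonNeg≢neg; neg-pos)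
  open import Data.Sum using (inj₁; inj₂)
  open import Function using (_∘_)
  open import Relation.Binary.Definitions using (tri<; tri≈; tri>)
  open import Relation.Binary.PropositionalEquality using (_≡_; _≢_; refl; sym; cong; subst; subst₂)
  open import Relation.Nullary using (Dec; yes; no; ¬_)
  open import Relation.Nullary.Decidable using (_×-dec_)
  open import Tactic.RingSolver using (solve-∀)
  open import Tactic.RingSolver.Core.AlmostCommutativeRing using (AlmostCommutativeRing; fromCommutativeRing)

  ring : AlmostCommutativeRing _ _
  ring = fromCommutativeRing +-*-commutativeRing 0≟
    where
    0≟ : ∀ x → Maybe (0ℚ ≡ x)
    0≟ x with 0ℚ ≟ℚ x
    ... | yes 0≡x = just 0≡x
    ... | no _    = nothing

  private variable
    p q : ℚ

  0≤+ : 0ℚ ≤ p → 0ℚ ≤ q → 0ℚ ≤ p + q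
  0≤+ = +-mono-≤

  0≤* : 0ℚ ≤ p → 0ℚ ≤ q → 0ℚ ≤ p * q
  0≤* {p} {q} 0≤p 0≤q = nonNegative⁻¹ _ {{nonNeg*nonNeg⇒nonNeg p {{nonNegative 0≤p}} q {{nonNegative 0≤q}}}}

  0<* : 0ℚ < p → 0ℚ < q → 0ℚ < p * q
  0<* {p} {q} 0<p 0<q = positive⁻¹ _ {{pos*pos⇒pos p {{positive 0<p}} q {{positive 0<q}}}}

  0<p*p : p ≢ 0ℚ → 0ℚ < p * p
  0<p*p {p} p≢0 with <-cmp p 0ℚ
  ... | tri< p<0 _ _ = positive⁻¹ _ {{neg*neg⇒pos p {{negative p<0}} p {{negative p<0}}}}
  ... | tri≈ _ p≡0 _ = ⊥-elim (p≢0 p≡0)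
  ... | tri> _ _ p>0 = 0<* p>0 p>0

  0≤p*p : ∀ p → 0ℚ ≤ p * p
  0≤p*p p with p ≟ℚ 0ℚ
  ... | yes refl = ≤-refl
  ... | no p≢0   = <⇒≤ (0<p*p p≢0)

  p*p+q*q≤0⇒p≡0 : p * p + q * q ≤ 0ℚ → p ≡ 0ℚ
  p*p+q*q≤0⇒p≡0 {p} {q} p²+q²≤0 with p ≟ℚ 0ℚ
  ... | yes p≡0 = p≡0
  ... | no p≢0  = ⊥-elim (<-irrefl refl (<-≤-trans (+-mono-<-≤ (0<p*p p≢0) (0≤p*p q)) p²+q²≤0))

  p≤q⇒0≤q-p : p ≤ q → 0ℚ ≤ q - p
  p≤q⇒0≤q-p {p} {q} p≤q = subst (_≤ q - p) (+-inverseʳ p) (+-monoˡ-≤ (- p) p≤q)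

  p<q⇒0<q-p : p < q → 0ℚ < q - p
  p<q⇒0<q-p {p} {q} p<q = subst (_< q - p) (+-inverseʳ p) (+-monoˡ-< (- p) p<q)

  0≤q-p⇒p≤q : 0ℚ ≤ q - p → p ≤ q
  0≤q-p⇒p≤q {q = q} {p = p} 0≤q-p = subst₂ _≤_ (+-identityˡ p) (q-p+p≡q p q) (+-monoˡ-≤ p 0≤q-p)
    where
    q-p+p≡q : ∀ p q → q - p + p ≡ q
    q-p+p≡q = solve-∀ ring

  0≰p⇒0≤-p : ¬ 0ℚ ≤ p → 0ℚ ≤ - p
  0≰p⇒0≤-p 0≰p = <⇒≤ (neg-antimono-< (≰⇒> 0≰p))

  -‿square : ∀ p → (- p) * (- p) ≡ p * p
  -‿square = solve-∀ ring

  nonNeg≢-pos : 0ℚ ≤ p → 0ℚ < q → p ≢ - q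
  nonNeg≢-pos {p} {q} 0≤p 0<q = nonNeg≢neg p (- q) {{nonNegative 0≤p}} {{neg-pos {q} (positive 0<q)}}

  three : ℚ
  three = 1ℚ + 1ℚ + 1ℚ

  0<three : 0ℚ < three
  0<three = positive⁻¹ three

  0≤three*p⇒0≤p : 0ℚ ≤ three * p → 0ℚ ≤ p
  0≤three*p⇒0≤p = *-cancelˡ-≤-pos three {{positive 0<three}}

  infix  7 _·_ _⨯_
  infixl 6 _−ᵥ_

  _·_ : Point → Point → ℚ
  (x₁ , y₁) · (x₂ , y₂) = x₁ * x₂ + y₁ * y₂

  _⨯_ : Point → Point → ℚ
  (x₁ , y₁) ⨯ (x₂ , y₂) = x₁ * y₂ - y₁ * x₂

  _−ᵥ_ : Point → Point → Point
  (x₁ , y₁) −ᵥ (x₂ , y₂) = (x₁ - x₂ , y₁ - y₂)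

  ‖_‖² : Point → ℚ
  ‖ a ‖² = a · a

  -- As complex numbers frame a b = conj(a) b, whose argument is the angle from a to b.
  frame : Point → Point → Point
  frame a b = (a · b , a ⨯ b)

  -- The closed wedge |arg t| ≤ 60°, using tan² 60° = 3.
  Wedge : Point → Set
  Wedge (x , y) = 0ℚ ≤ x × y * y ≤ three * (x * x)

  wedge? : ∀ t → Dec (Wedge t)
  wedge? (x , y) = 0ℚ ≤? x ×-dec y * y ≤? three * (x * x)

  Angle≤60° : Point → Point → Set
  Angle≤60° a b = Wedge (frame a b)

  angle≤60°-cong : ∀ a b a′ b′ → a · b ≡ a′ · b′ → (a ⨯ b) * (a ⨯ b) ≡ (a′ ⨯ b′) * (a′ ⨯ b′) →
                   Angle≤60° a b → Angle≤60° a′ b′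
  angle≤60°-cong a b a′ b′ d≡d′ X²≡X′² (0≤d , X²≤3d²) =
    subst (0ℚ ≤_) d≡d′ 0≤d , subst₂ (λ X² d → X² ≤ three * (d * d)) X²≡X′² d≡d′ X²≤3d²

  -- If w = ‖a − b‖² − ρ > 0, the right-hand side is negative; under the hypotheses of the next
  -- lemma every summand on the left is non-negative.
  cosine-law-identity : ∀ ρ a₁ a₂ b₁ b₂ →
    let A = a₁ * a₁ + a₂ * a₂
        B = b₁ * b₁ + b₂ * b₂
        d = a₁ * b₁ + a₂ * b₂
        X = a₁ * b₂ - a₂ * b₁
        w = (a₁ - b₁) * (a₁ - b₁) + (a₂ - b₂) * (a₂ - b₂) - ρ
    in (ρ - A + (ρ - B)) * (w + (d + d)) + (ρ - A) * (ρ - B) + (three * (d * d) - X * X)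
       ≡ - (w * (w + (d + d + d + d)))
  cosine-law-identity = solve-∀ ring

  angle≤60°⇒‖a−b‖²≤ : ∀ {ρ} a b → ‖ a ‖² ≤ ρ → ‖ b ‖² ≤ ρ → Angle≤60° a b → ‖ a −ᵥ b ‖² ≤ ρ
  angle≤60°⇒‖a−b‖²≤ {ρ} a@(a₁ , a₂) b@(b₁ , b₂) a≤ρ b≤ρ (0≤d , X²≤3d²) = ≮⇒≥ ρ≮‖a−b‖²
    where
    ρ≮‖a−b‖² : ¬ ρ < ‖ a −ᵥ b ‖²
    ρ≮‖a−b‖² ρ<‖a−b‖² =
      nonNeg≢-pos (0≤+ (0≤+ (0≤* (0≤+ 0≤ρ-A 0≤ρ-B) (<⇒≤ 0<w+2d)) (0≤* 0≤ρ-A 0≤ρ-B)) (p≤q⇒0≤q-p X²≤3d²))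
                  (0<* 0<w (+-mono-<-≤ 0<w (0≤+ (0≤+ (0≤+ 0≤d 0≤d) 0≤d) 0≤d)))
                  (cosine-law-identity ρ a₁ a₂ b₁ b₂)
      where
      0≤ρ-A : 0ℚ ≤ ρ - ‖ a ‖²
      0≤ρ-A = p≤q⇒0≤q-p a≤ρ
      0≤ρ-B : 0ℚ ≤ ρ - ‖ b ‖²
      0≤ρ-B = p≤q⇒0≤q-p b≤ρ
      0<w : 0ℚ < ‖ a −ᵥ b ‖² - ρ
      0<w = p<q⇒0<q-p ρ<‖a−b‖²
      0<w+2d : 0ℚ < ‖ a −ᵥ b ‖² - ρ + (a · b + a · b)
      0<w+2d = +-mono-<-≤ 0<w (0≤+ 0≤d 0≤d)

  -- The sectors 0° ≤ arg t ≤ 60° and 60° ≤ arg t ≤ 120°.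
  Sector₀ : Point → Set
  Sector₀ (x , y) = 0ℚ ≤ x × 0ℚ ≤ y × y * y ≤ three * (x * x)

  Sector₁ : Point → Set
  Sector₁ (x , y) = 0ℚ ≤ y × three * (x * x) ≤ y * y

  sector₀⇒angle≤60° : ∀ {a b} → Sector₀ a → Sector₀ b → Angle≤60° a b
  sector₀⇒angle≤60° {a@(x₁ , y₁)} {b@(x₂ , y₂)} (0≤x₁ , 0≤y₁ , flat₁) (0≤x₂ , 0≤y₂ , flat₂) =
    0≤+ (0≤* 0≤x₁ 0≤x₂) (0≤* 0≤y₁ 0≤y₂) , 0≤q-p⇒p≤q 0≤3d²-X²
    where
    0≤tail : 0ℚ ≤ three * ((y₁ * y₂) * (x₁ * x₂ + x₁ * x₂ + y₁ * y₂))
    0≤tail = 0≤* (<⇒≤ 0<three)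
                 (0≤* (0≤* 0≤y₁ 0≤y₂) (0≤+ (0≤+ (0≤* 0≤x₁ 0≤x₂) (0≤* 0≤x₁ 0≤x₂)) (0≤* 0≤y₁ 0≤y₂)))
    0≤3d²-X² : 0ℚ ≤ three * ((a · b) * (a · b)) - (a ⨯ b) * (a ⨯ b)
    0≤3d²-X² with ≤-total 0ℚ (a ⨯ b)
    ... | inj₁ 0≤X = subst (0ℚ ≤_) (sym (identity x₁ y₁ x₂ y₂))
            (0≤+ (0≤+ (0≤* (0≤* 0≤y₁ 0≤x₂) (0≤+ (0≤* 0≤x₁ 0≤y₂) 0≤X)) (0≤* (0≤p*p x₁) (p≤q⇒0≤q-p flat₂)))
                 0≤tail)
      where
      identity : ∀ x₁ y₁ x₂ y₂ → let d = x₁ * x₂ + y₁ * y₂ ; X = x₁ * y₂ - y₁ * x₂ in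
        three * (d * d) - X * X
          ≡ (y₁ * x₂) * (x₁ * y₂ + X) + (x₁ * x₁) * (three * (x₂ * x₂) - y₂ * y₂)
            + three * ((y₁ * y₂) * (x₁ * x₂ + x₁ * x₂ + y₁ * y₂))
      identity = solve-∀ ring
    ... | inj₂ X≤0 = subst (0ℚ ≤_) (sym (identity x₁ y₁ x₂ y₂))
            (0≤+ (0≤+ (0≤* (0≤* 0≤x₁ 0≤y₂) (0≤+ (0≤* 0≤y₁ 0≤x₂) (neg-antimono-≤ X≤0)))
                      (0≤* (0≤p*p x₂) (p≤q⇒0≤q-p flat₁)))
                 0≤tail)
      where
      identity : ∀ x₁ y₁ x₂ y₂ → let d = x₁ * x₂ + y₁ * y₂ ; X = x₁ * y₂ - y₁ * x₂ in
        three * (d * d) - X * X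
          ≡ (x₁ * y₂) * (y₁ * x₂ - X) + (x₂ * x₂) * (three * (x₁ * x₁) - y₁ * y₁)
            + three * ((y₁ * y₂) * (x₁ * x₂ + x₁ * x₂ + y₁ * y₂))
      identity = solve-∀ ring

  -- Here |xᵢ| ≤ yᵢ/√3, so 3x₁x₂ + y₁y₂ ≥ 0; with this, three times each claim is a sum of
  -- non-negative terms.
  sector₁⇒angle≤60° : ∀ {a b} → Sector₁ a → Sector₁ b → Angle≤60° a b
  sector₁⇒angle≤60° {x₁ , y₁} {x₂ , y₂} (0≤y₁ , steep₁) (0≤y₂ , steep₂) =
    0≤three*p⇒0≤p (subst (0ℚ ≤_) (sym (3d-identity x₁ y₁ x₂ y₂)) (0≤+ 0≤3p+q (0≤+ 0≤q 0≤q))) ,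
    0≤q-p⇒p≤q (0≤three*p⇒0≤p (subst (0ℚ ≤_) (sym (3[3d²-X²]-identity x₁ y₁ x₂ y₂))
      (0≤+ (0≤+ (0≤* 0≤3p+q (0≤+ 0≤3p+q (0≤* (<⇒≤ 0<three) (0≤+ 0≤q 0≤q)))) (0≤* 0≤r₁ (0≤p*p y₂)))
           (0≤* 0≤r₂ (0≤p*p y₁)))))
    where
    0≤q : 0ℚ ≤ y₁ * y₂
    0≤q = 0≤* 0≤y₁ 0≤y₂
    0≤r₁ : 0ℚ ≤ y₁ * y₁ - three * (x₁ * x₁)
    0≤r₁ = p≤q⇒0≤q-p steep₁
    0≤r₂ : 0ℚ ≤ y₂ * y₂ - three * (x₂ * x₂)
    0≤r₂ = p≤q⇒0≤q-p steep₂
    3p+q-identity : ∀ x₁ y₁ x₂ y₂ →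
      let r₁ = y₁ * y₁ - three * (x₁ * x₁) ; r₂ = y₂ * y₂ - three * (x₂ * x₂)
          q = y₁ * y₂ ; z = - (three * (x₁ * x₂) + q) in
      r₁ * r₂ + three * (x₂ * x₂) * r₁ + three * (x₁ * x₁) * r₂ ≡ - (z * (z + (q + q)))
    3p+q-identity = solve-∀ ring
    3d-identity : ∀ x₁ y₁ x₂ y₂ →
      three * (x₁ * x₂ + y₁ * y₂) ≡ (three * (x₁ * x₂) + y₁ * y₂) + (y₁ * y₂ + y₁ * y₂)
    3d-identity = solve-∀ ring
    3[3d²-X²]-identity : ∀ x₁ y₁ x₂ y₂ →
      let p = x₁ * x₂ ; q = y₁ * y₂ ; d = p + q ; X = x₁ * y₂ - y₁ * x₂ in
      three * (three * (d * d) - X * X)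
        ≡ (three * p + q) * ((three * p + q) + three * (q + q))
          + (y₁ * y₁ - three * (x₁ * x₁)) * (y₂ * y₂) + (y₂ * y₂ - three * (x₂ * x₂)) * (y₁ * y₁)
    3[3d²-X²]-identity = solve-∀ ring
    0≤3p+q : 0ℚ ≤ three * (x₁ * x₂) + y₁ * y₂
    0≤3p+q = ≮⇒≥ 3p+q≮0
      where
      3p+q≮0 : ¬ three * (x₁ * x₂) + y₁ * y₂ < 0ℚ
      3p+q≮0 3p+q<0 =
        nonNeg≢-pos (0≤+ (0≤+ (0≤* 0≤r₁ 0≤r₂) (0≤* (0≤* (<⇒≤ 0<three) (0≤p*p x₂)) 0≤r₁))
                         (0≤* (0≤* (<⇒≤ 0<three) (0≤p*p x₁)) 0≤r₂))
                    (0<* 0<z (+-mono-<-≤ 0<z (0≤+ 0≤q 0≤q)))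
                    (3p+q-identity x₁ y₁ x₂ y₂)
        where
        0<z : 0ℚ < - (three * (x₁ * x₂) + y₁ * y₂)
        0<z = neg-antimono-< 3p+q<0

  mirrorˣ : Point → Point
  mirrorˣ (x , y) = (- x , y)

  mirrorʸ : Point → Point
  mirrorʸ (x , y) = (x , - y)

  angle≤60°-mirrorˣ : ∀ {a b} → Angle≤60° (mirrorˣ a) (mirrorˣ b) → Angle≤60° a b
  angle≤60°-mirrorˣ {a@(x₁ , y₁)} {b@(x₂ , y₂)} =
    angle≤60°-cong (mirrorˣ a) (mirrorˣ b) a b (dot x₁ y₁ x₂ y₂) (cross² x₁ y₁ x₂ y₂)
    where
    dot : ∀ x₁ y₁ x₂ y₂ → (- x₁) * (- x₂) + y₁ * y₂ ≡ x₁ * x₂ + y₁ * y₂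
    dot = solve-∀ ring
    cross² : ∀ x₁ y₁ x₂ y₂ → let X′ = (- x₁) * y₂ - y₁ * (- x₂) ; X = x₁ * y₂ - y₁ * x₂ in X′ * X′ ≡ X * X
    cross² = solve-∀ ring

  angle≤60°-mirrorʸ : ∀ {a b} → Angle≤60° (mirrorʸ a) (mirrorʸ b) → Angle≤60° a b
  angle≤60°-mirrorʸ {a@(x₁ , y₁)} {b@(x₂ , y₂)} =
    angle≤60°-cong (mirrorʸ a) (mirrorʸ b) a b (dot x₁ y₁ x₂ y₂) (cross² x₁ y₁ x₂ y₂)
    where
    dot : ∀ x₁ y₁ x₂ y₂ → x₁ * x₂ + (- y₁) * (- y₂) ≡ x₁ * x₂ + y₁ * y₂
    dot = solve-∀ ring
    cross² : ∀ x₁ y₁ x₂ y₂ → let X′ = x₁ * (- y₂) - (- y₁) * x₂ ; X = x₁ * y₂ - y₁ * x₂ in X′ * X′ ≡ X * X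
    cross² = solve-∀ ring

  -- The four sectors [60°, 120°], [120°, 180°], [180°, 240°], [240°, 300°] outside the wedge.
  Sector : Fin 4 → Point → Set
  Sector zero                   t = Sector₁ t
  Sector (suc zero)             t = Sector₀ (mirrorˣ t)
  Sector (suc (suc zero))       t = Sector₀ (mirrorˣ (mirrorʸ t))
  Sector (suc (suc (suc zero))) t = Sector₁ (mirrorʸ t)

  same-sector⇒angle≤60° : ∀ s {a b} → Sector s a → Sector s b → Angle≤60° a b
  same-sector⇒angle≤60° zero                   {a} {b} sa sb = sector₁⇒angle≤60° {a} {b} sa sb
  same-sector⇒angle≤60° (suc zero)             {a} {b} sa sb =
    angle≤60°-mirrorˣ {a} {b} (sector₀⇒angle≤60° {mirrorˣ a} {mirrorˣ b} sa sb)
  same-sector⇒angle≤60° (suc (suc zero))       {a} {b} sa sb =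
    angle≤60°-mirrorʸ {a} {b} (angle≤60°-mirrorˣ {mirrorʸ a} {mirrorʸ b}
      (sector₀⇒angle≤60° {mirrorˣ (mirrorʸ a)} {mirrorˣ (mirrorʸ b)} sa sb))
  same-sector⇒angle≤60° (suc (suc (suc zero))) {a} {b} sa sb =
    angle≤60°-mirrorʸ {a} {b} (sector₁⇒angle≤60° {mirrorʸ a} {mirrorʸ b} sa sb)

  sector-of : ∀ t → ¬ Wedge t → ∃ λ s → Sector s t
  sector-of (x , y) t∉wedge with three * (x * x) ≤? y * y | 0ℚ ≤? y | 0ℚ ≤? x
  ... | yes steep | yes 0≤y | _       = zero , 0≤y , steep
  ... | yes steep | no 0≰y  | _       =
    suc (suc (suc zero)) , 0≰p⇒0≤-p 0≰y , subst (_ ≤_) (sym (-‿square y)) steep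
  ... | no flat   | _       | yes 0≤x = ⊥-elim (t∉wedge (0≤x , <⇒≤ (≰⇒> flat)))
  ... | no flat   | yes 0≤y | no 0≰x  =
    suc zero , 0≰p⇒0≤-p 0≰x , 0≤y , subst (_ ≤_) (cong (three *_) (sym (-‿square x))) (<⇒≤ (≰⇒> flat))
  ... | no flat   | no 0≰y  | no 0≰x  =
    suc (suc zero) , 0≰p⇒0≤-p 0≰x , 0≰p⇒0≤-p 0≰y ,
    subst₂ _≤_ (sym (-‿square y)) (cong (three *_) (sym (-‿square x))) (<⇒≤ (≰⇒> flat))

  angle≤60°-frame⁻¹ : ∀ r {a b} → 0ℚ < ‖ r ‖² → Angle≤60° (frame r a) (frame r b) → Angle≤60° a b
  angle≤60°-frame⁻¹ r@(r₁ , r₂) {a₁ , a₂} {b₁ , b₂} 0<R (0≤Rd , RX²≤3Rd²) =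
    *-cancelˡ-≤-pos R {{positive 0<R}} (subst₂ _≤_ (sym (*-zeroʳ R)) (dot r₁ r₂ a₁ a₂ b₁ b₂) 0≤Rd) ,
    *-cancelˡ-≤-pos (R * R) {{positive (0<* 0<R 0<R)}}
      (subst₂ _≤_ (cross² r₁ r₂ a₁ a₂ b₁ b₂) (dot² r₁ r₂ a₁ a₂ b₁ b₂) RX²≤3Rd²)
    where
    R : ℚ
    R = ‖ r ‖²
    dot : ∀ r₁ r₂ a₁ a₂ b₁ b₂ →
      (r₁ * a₁ + r₂ * a₂) * (r₁ * b₁ + r₂ * b₂) + (r₁ * a₂ - r₂ * a₁) * (r₁ * b₂ - r₂ * b₁)
        ≡ (r₁ * r₁ + r₂ * r₂) * (a₁ * b₁ + a₂ * b₂)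
    dot = solve-∀ ring
    dot² : ∀ r₁ r₂ a₁ a₂ b₁ b₂ →
      let d′ = (r₁ * a₁ + r₂ * a₂) * (r₁ * b₁ + r₂ * b₂) + (r₁ * a₂ - r₂ * a₁) * (r₁ * b₂ - r₂ * b₁)
          R = r₁ * r₁ + r₂ * r₂ ; d = a₁ * b₁ + a₂ * b₂ in
      three * (d′ * d′) ≡ (R * R) * (three * (d * d))
    dot² = solve-∀ ring
    cross² : ∀ r₁ r₂ a₁ a₂ b₁ b₂ →
      let X′ = (r₁ * a₁ + r₂ * a₂) * (r₁ * b₂ - r₂ * b₁) - (r₁ * a₂ - r₂ * a₁) * (r₁ * b₁ + r₂ * b₂)
          R = r₁ * r₁ + r₂ * r₂ ; X = a₁ * b₂ - a₂ * b₁ in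
      X′ * X′ ≡ (R * R) * (X * X)
    cross² = solve-∀ ring

  angle≤60°-zeroˡ : ∀ {a} b → ‖ a ‖² ≤ 0ℚ → Angle≤60° a b
  angle≤60°-zeroˡ {a₁ , a₂} b@(b₁ , b₂) ‖a‖²≤0
    with refl ← p*p+q*q≤0⇒p≡0 {a₁} {a₂} ‖a‖²≤0
    with refl ← p*p+q*q≤0⇒p≡0 {a₂} {0ℚ} (subst (_≤ 0ℚ) (+-comm (0ℚ * 0ℚ) (a₂ * a₂)) ‖a‖²≤0) =
    angle≤60°-cong 𝟎 𝟎 𝟎 b (dot b₁ b₂) (cross² b₁ b₂) (≤-refl , ≤-refl)
    where
    𝟎 : Point
    𝟎 = (0ℚ , 0ℚ)
    dot : ∀ b₁ b₂ → 0ℚ ≡ 0ℚ * b₁ + 0ℚ * b₂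
    dot = solve-∀ ring
    cross² : ∀ b₁ b₂ → 0ℚ ≡ (0ℚ * b₂ - 0ℚ * b₁) * (0ℚ * b₂ - 0ℚ * b₁)
    cross² = solve-∀ ring

  two-in-one-sector : (t : Fin 5 → Point) → (∀ i → ¬ Wedge (t i)) →
                      ∃₂ λ i j → i ≢ j × ∃ λ s → Sector s (t i) × Sector s (t j)
  two-in-one-sector t outside-wedge = same-sector (pigeonhole (n<1+n 4) (proj₁ ∘ sector))
    where
    sector : ∀ i → ∃ λ s → Sector s (t i)
    sector i = sector-of (t i) (outside-wedge i)
    same-sector : (∃₂ λ i j → i <ᶠ j × proj₁ (sector i) ≡ proj₁ (sector j)) →
                  ∃₂ λ i j → i ≢ j × ∃ λ s → Sector s (t i) × Sector s (t j)
    same-sector (i , j , i<j , same) =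
      i , j , <⇒≢ i<j , proj₁ (sector i) , proj₂ (sector i) ,
      subst (λ s → Sector s (t j)) (sym same) (proj₂ (sector j))

  -- In the frame of a₀ ≠ 0 either some other aᵢ lies in the wedge, or two of the five others
  -- share one of the four sectors.
  two-of-six-within-60° : (a : Fin 6 → Point) → ∃₂ λ i j → i ≢ j × Angle≤60° (a i) (a j)
  two-of-six-within-60° a with 0ℚ <? ‖ a zero ‖² | any? (λ i → wedge? (frame (a zero) (a (suc i))))
  ... | no ‖a₀‖²≯0 | _ = zero , suc zero , (λ ()) , angle≤60°-zeroˡ {a zero} (a (suc zero)) (≮⇒≥ ‖a₀‖²≯0)
  ... | yes _ | yes (i , a₀∠aᵢ) = zero , suc i , (λ ()) , a₀∠aᵢ
  ... | yes 0<‖a₀‖² | no none-in-wedge =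
    within-60° (two-in-one-sector t (λ i t∈wedge → none-in-wedge (i , t∈wedge)))
    where
    t : Fin 5 → Point
    t i = frame (a zero) (a (suc i))
    within-60° : (∃₂ λ i j → i ≢ j × ∃ λ s → Sector s (t i) × Sector s (t j)) →
                 ∃₂ λ i j → i ≢ j × Angle≤60° (a i) (a j)
    within-60° (i , j , i≢j , s , sᵢ , sⱼ) =
      suc i , suc j , i≢j ∘ suc-injective ,
      angle≤60°-frame⁻¹ (a zero) {a (suc i)} {a (suc j)} 0<‖a₀‖² (same-sector⇒angle≤60° s {t i} {t j} sᵢ sⱼ)

  six-points-in-disk : ∀ {ρ} c (P : Fin 6 → Point) → (∀ i → sqDist (P i) c ≤ ρ) →
                       ∃₂ λ i j → i ≢ j × sqDist (P i) (P j) ≤ ρ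
  six-points-in-disk {ρ} c P near = close (two-of-six-within-60° (λ i → P i −ᵥ c))
    where
    translate : ∀ p q → ‖ (p −ᵥ c) −ᵥ (q −ᵥ c) ‖² ≡ sqDist p q
    translate (x₁ , y₁) (x₂ , y₂) = identity x₁ y₁ x₂ y₂ (proj₁ c) (proj₂ c)
      where
      identity : ∀ x₁ y₁ x₂ y₂ x y →
        ((x₁ - x) - (x₂ - x)) * ((x₁ - x) - (x₂ - x)) + ((y₁ - y) - (y₂ - y)) * ((y₁ - y) - (y₂ - y))
          ≡ (x₁ - x₂) * (x₁ - x₂) + (y₁ - y₂) * (y₁ - y₂)
      identity = solve-∀ ring
    close : (∃₂ λ i j → i ≢ j × Angle≤60° (P i −ᵥ c) (P j −ᵥ c)) → ∃₂ λ i j → i ≢ j × sqDist (P i) (P j) ≤ ρ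
    close (i , j , i≢j , angle) =
      i , j , i≢j ,
      subst (_≤ ρ) (translate (P i) (P j)) (angle≤60°⇒‖a−b‖²≤ (P i −ᵥ c) (P j −ᵥ c) (near i) (near j) angle)

  sqDist-self : ∀ p → sqDist p p ≡ 0ℚ
  sqDist-self (x , y) = identity x y
    where
    identity : ∀ x y → (x - x) * (x - x) + (y - y) * (y - y) ≡ 0ℚ
    identity = solve-∀ ring

open import Data.Nat using (ℕ; zero; suc; _≤_; _<_; _+_; _*_; z≤n; s≤s)
open import Data.Fin.Subset using (Subset; inside; outside; ⊥; _∈_; _⊆_; _∪_; _∩_; ⁅_⁆; ∣_∣)
open import Data.Product using (Σ; ∃; ∃₂; _×_; _,_; proj₁; proj₂)

open import Data.Empty using (⊥-elim)
open import Data.Fin using (Fin; zero; suc; _≟_)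
open import Data.Fin.Properties using (any?; suc-injective)
open import Data.Fin.Subset.Properties
  using (_∈?_; ∣⊥∣≡0; x∈p∪q⁺; x∈p∩q⁺; x∈p∩q⁻; x∈⁅x⁆; ∣⁅x⁆∣≡1; p⊆q⇒∣p∣≤∣q∣)
open import Data.Nat.Properties
  using (≤-trans; ≤-reflexive; ≤-antisym; <-cmp; n≤1+n; n≤0⇒n≡0; 0≢1+n; +-suc; *-suc; *-assoc;
         +-mono-≤; +-monoʳ-≤; *-monoʳ-≤; _≤?_; ≰⇒>; module ≤-Reasoning)
  renaming (suc-injective to ℕ-suc-injective)
open import Data.Rational using () renaming (_≤_ to _≤ℚ_; _≤?_ to _≤ℚ?_)
open import Data.Rational.Properties using (nonNegative⁻¹)
open import Data.Sum using (_⊎_; inj₁; inj₂)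
open import Data.Vec using ([]; _∷_; tabulate; here; there)
open import Data.Vec.Properties using (lookup∘tabulate; lookup⇒[]=; []=⇒lookup)
import Data.Vec.Functional as Vector
open import Function using (_∘_)
open import Function.Bundles using (_⇔_; Equivalence)
open import Function.Definitions using (Injective)
open import Level using (Level)
open import Relation.Binary.Definitions using (tri<; tri≈; tri>)
open import Relation.Binary.PropositionalEquality using (_≡_; _≢_; refl; sym; trans; cong; subst)
open import Relation.Nullary using (Dec; does; yes; no; ¬_)
open import Relation.Nullary.Decidable using (dec-true; map′; _×-dec_; _⊎-dec_)
open import Relation.Unary using (Pred; Decidable)

open Equivalence using (to; from)

open Plane using (six-points-in-disk; sqDist-self)

private variable
  ℓ : Level
  m n k : ℕ

∣p∪q∣≤∣p∣+∣q∣ : ∀ (p q : Subset n) → ∣ p ∪ q ∣ ≤ ∣ p ∣ + ∣ q ∣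
∣p∪q∣≤∣p∣+∣q∣ []            []            = z≤n
∣p∪q∣≤∣p∣+∣q∣ (inside  ∷ p) (inside  ∷ q) = s≤s (≤-trans (∣p∪q∣≤∣p∣+∣q∣ p q) (+-monoʳ-≤ ∣ p ∣ (n≤1+n ∣ q ∣)))
∣p∪q∣≤∣p∣+∣q∣ (inside  ∷ p) (outside ∷ q) = s≤s (∣p∪q∣≤∣p∣+∣q∣ p q)
∣p∪q∣≤∣p∣+∣q∣ (outside ∷ p) (inside  ∷ q) = ≤-trans (s≤s (∣p∪q∣≤∣p∣+∣q∣ p q)) (≤-reflexive (sym (+-suc ∣ p ∣ ∣ q ∣)))
∣p∪q∣≤∣p∣+∣q∣ (outside ∷ p) (outside ∷ q) = ∣p∪q∣≤∣p∣+∣q∣ p q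

unionOver : Subset m → (Fin m → Subset n) → Subset n
unionOver []            F = ⊥
unionOver (inside  ∷ K) F = F zero ∪ unionOver K (F ∘ suc)
unionOver (outside ∷ K) F = unionOver K (F ∘ suc)

syntax unionOver K (λ x → F) = ⋃[ x ∈ K ] F

∈-unionOver⁺ : ∀ {K : Subset m} {F : Fin m → Subset n} {x y} → x ∈ K → y ∈ F x → y ∈ unionOver K F
∈-unionOver⁺ {K = inside  ∷ K} here        y∈Fx = x∈p∪q⁺ (inj₁ y∈Fx)
∈-unionOver⁺ {K = inside  ∷ K} (there x∈K) y∈Fx = x∈p∪q⁺ (inj₂ (∈-unionOver⁺ x∈K y∈Fx))
∈-unionOver⁺ {K = outside ∷ K} (there x∈K) y∈Fx = ∈-unionOver⁺ x∈K y∈Fx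

∣unionOver∣≤ : ∀ (K : Subset m) {F : Fin m → Subset n} → (∀ {x} → x ∈ K → ∣ F x ∣ ≤ k) →
               ∣ unionOver K F ∣ ≤ k * ∣ K ∣
∣unionOver∣≤ {n = n} [] _ = ≤-trans (≤-reflexive (∣⊥∣≡0 n)) z≤n
∣unionOver∣≤ {k = k} (inside ∷ K) {F} ∣F∣≤k = begin
  ∣ F zero ∪ unionOver K (F ∘ suc) ∣      ≤⟨ ∣p∪q∣≤∣p∣+∣q∣ (F zero) _ ⟩
  ∣ F zero ∣ + ∣ unionOver K (F ∘ suc) ∣  ≤⟨ +-mono-≤ (∣F∣≤k here) (∣unionOver∣≤ K (∣F∣≤k ∘ there)) ⟩
  k + k * ∣ K ∣                           ≡⟨ sym (*-suc k ∣ K ∣) ⟩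
  k * suc ∣ K ∣                           ∎
  where open ≤-Reasoning
∣unionOver∣≤ (outside ∷ K) ∣F∣≤k = ∣unionOver∣≤ K (∣F∣≤k ∘ there)

k≤∣p∣⇒injection : ∀ (p : Subset n) {k} → k ≤ ∣ p ∣ →
                  Σ (Fin k → Fin n) λ f → Injective _≡_ _≡_ f × (∀ i → f i ∈ p)
k≤∣p∣⇒injection p             {zero}  _ = (λ ()) , (λ { {()} }) , (λ ())
k≤∣p∣⇒injection (inside  ∷ p) {suc k} (s≤s k≤∣p∣) with k≤∣p∣⇒injection p k≤∣p∣
... | f , f-inj , f∈p = zero Vector.∷ (suc ∘ f) , inj , (λ { zero → here ; (suc i) → there (f∈p i) })
  where
  inj : Injective _≡_ _≡_ (zero Vector.∷ (suc ∘ f))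
  inj {zero}  {zero}  _  = refl
  inj {suc i} {suc j} eq = cong suc (f-inj (suc-injective eq))
k≤∣p∣⇒injection (outside ∷ p) {suc k} k≤∣p∣ with k≤∣p∣⇒injection p k≤∣p∣
... | f , f-inj , f∈p = suc ∘ f , f-inj ∘ suc-injective , there ∘ f∈p

module _ {P : Pred (Fin n) ℓ} (P? : Decidable P) where

  subsetOf : Subset n
  subsetOf = tabulate (does ∘ P?)

  ∈-subsetOf⁺ : ∀ {x} → P x → x ∈ subsetOf
  ∈-subsetOf⁺ {x} px = lookup⇒[]= x subsetOf (trans (lookup∘tabulate (does ∘ P?) x) (dec-true (P? x) px))

  ∈-subsetOf⁻ : ∀ {x} → x ∈ subsetOf → P x
  ∈-subsetOf⁻ {x} x∈ with P? x | trans (sym (lookup∘tabulate (does ∘ P?) x)) ([]=⇒lookup x∈)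
  ... | yes px | _  = px
  ... | no _   | ()

Independent : Graph n → Subset n → Set
Independent G S = ∀ {u w} → u ∈ S → w ∈ S → ¬ Adj G u w

total⇒dominating : ∀ {G : Graph n} {T} → TotalDominating G T → Dominating G T
total⇒dominating T-total u _ = T-total u

module _ {G : Graph n} where

  walk-length-0 : ∀ {a b} → Walk G a b 0 → a ≡ b
  walk-length-0 here = refl

  walk-snoc : ∀ {a b c k} → Walk G a b k → Adj G b c → Walk G a c (suc k)
  walk-snoc here         bc = step bc here
  walk-snoc (step ab w) bc = step ab (walk-snoc w bc)

  module _ {S : Subset n} where

    walkIn-start : ∀ {a b} → WalkIn G S a b → a ∈ S
    walkIn-start (here a∈S)     = a∈S
    walkIn-start (step a∈S _ _) = a∈S

    walkIn-trans : ∀ {a b c} → WalkIn G S a b → WalkIn G S b c → WalkIn G S a c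
    walkIn-trans (here _)         q = q
    walkIn-trans (step a∈S ab p) q = step a∈S ab (walkIn-trans p q)

    walkIn-sym : ∀ {a b} → WalkIn G S a b → WalkIn G S b a
    walkIn-sym (here a∈S)       = here a∈S
    walkIn-sym (step a∈S ab p) = walkIn-trans (walkIn-sym p) (step (walkIn-start p) (adj-sym G ab) (here a∈S))

module CDOM {G : Graph n} (adj? : ∀ u w → Dec (Adj G u w)) {D : Subset n} (run : CDOMRun G D) where
  open CDOMRun run

  private variable
    i j : ℕ
    u w : Fin n

  lvl-root : lvl v ≡ 0
  lvl-root = n≤0⇒n≡0 (proj₂ (lvl-dist v) 0 here)

  lvl≡0⇒root : lvl u ≡ 0 → u ≡ v
  lvl≡0⇒root {u} lvl≡0 = sym (walk-length-0 (subst (Walk G v u) lvl≡0 (proj₁ (lvl-dist u))))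

  lvl≡suc⇒≢root : lvl u ≡ suc i → u ≢ v
  lvl≡suc⇒≢root lvl≡suc refl = 0≢1+n (trans (sym lvl-root) lvl≡suc)

  lvl-adj : Adj G u w → lvl w ≤ suc (lvl u)
  lvl-adj {u} {w} uw = proj₂ (lvl-dist w) _ (walk-snoc (proj₁ (lvl-dist u)) uw)

  IS-lvl : ∀ i → u ∈ IS i → lvl u ≡ i
  IS-lvl zero    u∈IS = trans (cong lvl (to (IS₀ _) u∈IS)) lvl-root
  IS-lvl (suc i) u∈IS = IS-level i _ u∈IS

  IS⊆D : u ∈ IS i → u ∈ D
  IS⊆D u∈IS = from (output _) (_ , inj₁ u∈IS)

  NS⊆D : u ∈ NS i → u ∈ D
  NS⊆D u∈NS = from (output _) (_ , inj₂ u∈NS)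

  parent : u ∈ IS (suc i) → Adj G (par u) u × lvl (par u) ≡ i
  parent {u} {i} u∈IS with par-ok u (lvl≡suc⇒≢root (IS-level i u u∈IS))
  ... | par-u~u , lvl-par = par-u~u , ℕ-suc-injective (trans lvl-par (IS-level i u u∈IS))

  parent∈D : u ∈ IS (suc i) → par u ∈ D
  parent∈D {u} {i} u∈IS = NS⊆D (from (NS-def i (par u)) (u , u∈IS , refl))

  IS-independent : ∀ i → u ∈ IS i → w ∈ IS i → ¬ Adj G u w
  IS-independent {u} {w} zero u∈IS w∈IS uw
    with refl ← to (IS₀ u) u∈IS | refl ← to (IS₀ w) w∈IS = irrefl G uw
  IS-independent (suc i) u∈IS w∈IS = IS-indep i _ _ u∈IS w∈IS

  covered-by-IS : lvl u ≡ suc j →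
    (∃ λ w → w ∈ IS j × Adj G u w) ⊎ u ∈ IS (suc j) ⊎ (∃ λ w → w ∈ IS (suc j) × Adj G u w)
  covered-by-IS {u} {j} lvl≡ with any? (λ w → w ∈? IS j ×-dec adj? u w) | u ∈? IS (suc j)
  ... | yes below   | _        = inj₁ below
  ... | no _        | yes u∈IS = inj₂ (inj₁ u∈IS)
  ... | no no-below | no u∉IS  =
    inj₂ (inj₂ (IS-max j u lvl≡ (λ w w∈IS uw → no-below (w , w∈IS , uw)) u∉IS))

  dominating : Dominating G D
  dominating u u∉D with lvl u in lvl≡
  ... | zero  = ⊥-elim (u∉D (IS⊆D (from (IS₀ u) (lvl≡0⇒root lvl≡))))
  ... | suc j with covered-by-IS lvl≡
  ...   | inj₁ (w , w∈IS , uw)        = w , IS⊆D w∈IS , uw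
  ...   | inj₂ (inj₁ u∈IS)            = ⊥-elim (u∉D (IS⊆D u∈IS))
  ...   | inj₂ (inj₂ (w , w∈IS , uw)) = w , IS⊆D w∈IS , uw

  reach-root : ∀ i → lvl u ≡ i → u ∈ D → WalkIn G D u v
  reach-root-via-parent : ∀ j → w ∈ IS (suc j) → WalkIn G D w v

  reach-root zero    lvl≡0 u∈D = subst (WalkIn G D _) (lvl≡0⇒root lvl≡0) (here u∈D)
  reach-root (suc j) lvl≡  u∈D with covered-by-IS lvl≡
  ... | inj₁ (w , w∈IS , uw)        = step u∈D uw (reach-root j (IS-lvl j w∈IS) (IS⊆D w∈IS))
  ... | inj₂ (inj₁ u∈IS)            = reach-root-via-parent j u∈IS
  ... | inj₂ (inj₂ (w , w∈IS , uw)) = step u∈D uw (reach-root-via-parent j w∈IS)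

  reach-root-via-parent j w∈IS =
    step (IS⊆D w∈IS) (adj-sym G (proj₁ (parent w∈IS))) (reach-root j (proj₂ (parent w∈IS)) (parent∈D w∈IS))

  connectedDominating : ConnectedDominating G D
  connectedDominating = dominating , λ u w u∈D w∈D →
    walkIn-trans (reach-root _ refl u∈D) (walkIn-sym (reach-root _ refl w∈D))

  -- I is the union of all IS i; u ∈ IS i forces i ≡ lvl u, so only one level needs testing.
  in-own-level? : ∀ u → Dec (u ∈ IS (lvl u))
  in-own-level? u = u ∈? IS (lvl u)

  I : Subset n
  I = subsetOf in-own-level?

  IS⊆I : u ∈ IS i → u ∈ I
  IS⊆I {u} {i} u∈IS = ∈-subsetOf⁺ in-own-level? (subst (λ j → u ∈ IS j) (sym (IS-lvl i u∈IS)) u∈IS)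

  I⊆IS : u ∈ I → u ∈ IS (lvl u)
  I⊆IS = ∈-subsetOf⁻ in-own-level?

  no-edge-to-next-level : u ∈ I → w ∈ I → lvl u < lvl w → ¬ Adj G u w
  no-edge-to-next-level {u} {w} u∈I w∈I lvl< uw =
    IS-notDS (lvl u) w u (subst (λ i → w ∈ IS i) lvl-w≡ (I⊆IS w∈I)) (I⊆IS u∈I) (adj-sym G uw)
    where
    lvl-w≡ : lvl w ≡ suc (lvl u)
    lvl-w≡ = ≤-antisym (lvl-adj uw) lvl<

  I-independent : Independent G I
  I-independent {u} {w} u∈I w∈I uw with <-cmp (lvl u) (lvl w)
  ... | tri< lvl< _ _ = no-edge-to-next-level u∈I w∈I lvl< uw
  ... | tri≈ _ lvl≡ _ = IS-independent (lvl w) (subst (λ i → u ∈ IS i) lvl≡ (I⊆IS u∈I)) (I⊆IS w∈I) uw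
  ... | tri> _ _ lvl> = no-edge-to-next-level w∈I u∈I lvl> (adj-sym G uw)

  D⊆I∪parents : D ⊆ I ∪ ⋃[ w ∈ I ] ⁅ par w ⁆
  D⊆I∪parents {u} u∈D with to (output u) u∈D
  ... | i     , inj₁ u∈IS = x∈p∪q⁺ (inj₁ (IS⊆I u∈IS))
  ... | zero  , inj₂ u∈NS = ⊥-elim (NS₀ u u∈NS)
  ... | suc i , inj₂ u∈NS with to (NS-def i u) u∈NS
  ...   | w , w∈IS , refl = x∈p∪q⁺ (inj₂ (∈-unionOver⁺ (IS⊆I w∈IS) (x∈⁅x⁆ (par w))))

  ∣D∣≤2∣I∣ : ∣ D ∣ ≤ 2 * ∣ I ∣
  ∣D∣≤2∣I∣ = begin
    ∣ D ∣                             ≤⟨ p⊆q⇒∣p∣≤∣q∣ D⊆I∪parents ⟩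
    ∣ I ∪ ⋃[ w ∈ I ] ⁅ par w ⁆ ∣      ≤⟨ ∣p∪q∣≤∣p∣+∣q∣ I _ ⟩
    ∣ I ∣ + ∣ ⋃[ w ∈ I ] ⁅ par w ⁆ ∣  ≤⟨ +-monoʳ-≤ ∣ I ∣ (∣unionOver∣≤ I (λ {w} _ → ≤-reflexive (∣⁅x⁆∣≡1 (par w)))) ⟩
    2 * ∣ I ∣                         ∎
    where open ≤-Reasoning

module UnitDiskGraph (G : Graph n) (ud : UnitDisk G) where

  centre : Fin n → Point
  centre = proj₁ ud

  adj⇔near : ∀ {u w} → u ≢ w → Adj G u w ⇔ sqDist (centre u) (centre w) ≤ℚ four
  adj⇔near = proj₂ (proj₂ ud) _ _

  adj? : ∀ u w → Dec (Adj G u w)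
  adj? u w with u ≟ w
  ... | yes refl = no (irrefl G)
  ... | no u≢w   = map′ (from (adj⇔near u≢w)) (to (adj⇔near u≢w)) (sqDist (centre u) (centre w) ≤ℚ? four)

  closed-neighbour? : ∀ b u → Dec (u ≡ b ⊎ Adj G u b)
  closed-neighbour? b u = u ≟ b ⊎-dec adj? u b

  N[_] : Fin n → Subset n
  N[ b ] = subsetOf (closed-neighbour? b)

  N[b]-near : ∀ {b u} → u ∈ N[ b ] → sqDist (centre u) (centre b) ≤ℚ four
  N[b]-near {b} u∈N[b] with ∈-subsetOf⁻ (closed-neighbour? b) u∈N[b]
  ... | inj₁ refl = subst (_≤ℚ four) (sym (sqDist-self (centre b))) (nonNegative⁻¹ four)
  ... | inj₂ ub   = to (adj⇔near (λ { refl → irrefl G ub })) ub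

  no-six-independent-in-N[_] : ∀ b {S} → Independent G S → (f : Fin 6 → Fin n) → Injective _≡_ _≡_ f →
                                ¬ (∀ i → f i ∈ S ∩ N[ b ])
  no-six-independent-in-N[ b ] {S} S-indep f f-inj f∈S∩N[b] =
    no-close-pair (six-points-in-disk (centre b) (centre ∘ f) (N[b]-near ∘ proj₂ ∘ split))
    where
    split : ∀ i → f i ∈ S × f i ∈ N[ b ]
    split i = x∈p∩q⁻ S N[ b ] (f∈S∩N[b] i)
    no-close-pair : ¬ ∃₂ λ i j → i ≢ j × sqDist (centre (f i)) (centre (f j)) ≤ℚ four
    no-close-pair (i , j , i≢j , close) =
      S-indep (proj₁ (split i)) (proj₁ (split j)) (from (adj⇔near (i≢j ∘ f-inj)) close)

  ∣S∩N[b]∣≤5 : ∀ {S} → Independent G S → ∀ b → ∣ S ∩ N[ b ] ∣ ≤ 5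
  ∣S∩N[b]∣≤5 {S} S-indep b with ∣ S ∩ N[ b ] ∣ ≤? 5
  ... | yes ∣S∩N[b]∣≤5 = ∣S∩N[b]∣≤5
  ... | no ∣S∩N[b]∣≰5 with k≤∣p∣⇒injection (S ∩ N[ b ]) (≰⇒> ∣S∩N[b]∣≰5)
  ...   | f , f-inj , f∈S∩N[b] = ⊥-elim (no-six-independent-in-N[ b ] S-indep f f-inj f∈S∩N[b])

  ∣independent∣≤5∣dominating∣ : ∀ {S K} → Independent G S → Dominating G K → ∣ S ∣ ≤ 5 * ∣ K ∣
  ∣independent∣≤5∣dominating∣ {S} {K} S-indep K-dom = begin
    ∣ S ∣                        ≤⟨ p⊆q⇒∣p∣≤∣q∣ S⊆⋃N ⟩
    ∣ ⋃[ b ∈ K ] (S ∩ N[ b ]) ∣  ≤⟨ ∣unionOver∣≤ K (λ {b} _ → ∣S∩N[b]∣≤5 S-indep b) ⟩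
    5 * ∣ K ∣                    ∎
    where
    open ≤-Reasoning
    S⊆⋃N : S ⊆ ⋃[ b ∈ K ] (S ∩ N[ b ])
    S⊆⋃N {u} u∈S with u ∈? K
    ... | yes u∈K = ∈-unionOver⁺ u∈K (x∈p∩q⁺ (u∈S , ∈-subsetOf⁺ (closed-neighbour? u) (inj₁ refl)))
    ... | no u∉K  = let (b , b∈K , ub) = K-dom u u∉K in
                    ∈-unionOver⁺ b∈K (x∈p∩q⁺ (u∈S , ∈-subsetOf⁺ (closed-neighbour? b) (inj₂ ub)))

  ∣CDOM∣≤10∣dominating∣ : ∀ {D K} → CDOMRun G D → Dominating G K → ∣ D ∣ ≤ 10 * ∣ K ∣
  ∣CDOM∣≤10∣dominating∣ {D} {K} run K-dom = begin
    ∣ D ∣            ≤⟨ ∣D∣≤2∣I∣ ⟩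
    2 * ∣ I ∣        ≤⟨ *-monoʳ-≤ 2 (∣independent∣≤5∣dominating∣ I-independent K-dom) ⟩
    2 * (5 * ∣ K ∣)  ≡⟨ sym (*-assoc 2 5 ∣ K ∣) ⟩
    10 * ∣ K ∣       ∎
    where
    open ≤-Reasoning
    open CDOM adj? run

theorem4p9 : ∀ {n} (G : Graph n) → UnitDisk G → Connected G →
    ∀ (D : Subset n) → CDOMRun G D →
      ConnectedDominating G D
      × (∀ (C : Subset n) → ConnectedDominating G C → ∣ D ∣ ≤ 10 * ∣ C ∣)
      × (∀ (T : Subset n) → TotalDominating G T → ∣ D ∣ ≤ 10 * ∣ T ∣)
theorem4p9 G ud _ D run =
  connectedDominating ,
  (λ C C-cds → ∣CDOM∣≤10∣dominating∣ run (proj₁ C-cds)) ,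
  (λ T T-tds → ∣CDOM∣≤10∣dominating∣ run (total⇒dominating {G = G} T-tds))
  where
  open UnitDiskGraph G ud
  open CDOM adj? run
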